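{- Let $G=(V,E)$ be a connected graph. If there is a set $D\subseteq V$ such that $G[D]$ is connected and every vertex in $V\setminus D$ has at least two neighbors in $D$, then $\mathrm{rc}(G) \le |D|+1$.
   Context: $\mathrm{rc}(G)$ denotes the rainbow connection number: the minimum number of colors in an edge-coloring of $G$ such that every pair of vertices is joined by a path whose edges have pairwise distinct colors. -}

module Defs where

open import Data.Nat using (ℕ; suc; _+_)
open import Data.Fin using (Fin)
open import Data.List using (List; []; _∷_; map)
open import Data.List.Relation.Unary.Unique.Propositional using (Unique)
open import Data.List.Relation.Unary.All using (All)
open import Data.List.Relation.Unary.Any using (Any)
open import Data.Product using (Σ; _×_; ∃-syntax; _,_)
open import Data.Fin.Subset using (Subset; _∈_; _∉_; ∣_∣)
open import Relation.Binary.PropositionalEquality using (_≡_; _≢_)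
open import Relation.Nullary using (¬_)

record Graph (n : ℕ) : Set₁ where
  field
    Adj   : Fin n → Fin n → Set
    sym   : ∀ {u v} → Adj u v → Adj v u
    irrefl : ∀ {u} → ¬ Adj u u
open Graph public

data Walk {n : ℕ} (G : Graph n) : Fin n → Fin n → Set where
  [_]  : (u : Fin n) → Walk G u u
  _∷⟨_⟩_ : (u : Fin n) {w v : Fin n} → Adj G u w → Walk G w v → Walk G u v

vertices : ∀ {n} {G : Graph n} {u v} → Walk G u v → List (Fin n)
vertices [ u ] = u ∷ []
vertices (u ∷⟨ _ ⟩ p) = u ∷ vertices p

Connected : ∀ {n} → Graph n → Set
Connected {n} G = (u v : Fin n) → Walk G u v

InducedConnected : ∀ {n} → Graph n → Subset n → Set
InducedConnected {n} G D =
  (u v : Fin n) → u ∈ D → v ∈ D →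
  Σ (Walk G u v) λ p → All (_∈ D) (vertices p)

TwoNeighboursIn : ∀ {n} → Graph n → Subset n → Fin n → Set
TwoNeighboursIn {n} G D v =
  ∃[ a ] ∃[ b ] (a ≢ b × a ∈ D × b ∈ D × Adj G v a × Adj G v b)

record EdgeColouring {n : ℕ} (G : Graph n) (k : ℕ) : Set where
  field
    col     : (u v : Fin n) → Adj G u v → Fin k
    col-sym : ∀ {u v} (e : Adj G u v) → col v u (sym G e) ≡ col u v e
open EdgeColouring public

colours : ∀ {n k} {G : Graph n} (c : EdgeColouring G k) {u v} → Walk G u v → List (Fin k)
colours c [ u ] = []
colours c (u ∷⟨ e ⟩ p) = col c u _ e ∷ colours c p

RainbowPath : ∀ {n k} {G : Graph n} → EdgeColouring G k → ∀ {u v} → Walk G u v → Set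
RainbowPath c p = Unique (vertices p) × Unique (colours c p)

RainbowColouring : ∀ {n k} {G : Graph n} → EdgeColouring G k → Set
RainbowColouring {n} {G = G} c = (u v : Fin n) → Σ (Walk G u v) (RainbowPath c)

rc≤ : ∀ {n} → Graph n → ℕ → Set
rc≤ G k = Σ (EdgeColouring G k) RainbowColouring

module Submission where

-- Fix a root r ∈ D.  Since G[D] is connected there is a walk from r that
-- stays inside D and visits every vertex of D; sending each vertex x ≠ r of D
-- to the vertex from which this walk first reached x gives a spanning tree of
-- G[D] in which every parent is discovered strictly earlier than its child.
-- The colours are Fin (1 + |D|): the rank of each vertex inside D, plus one
-- extra colour.  An edge inside D is coloured by the rank of its later
-- discovered endpoint, so every tree edge carries the rank of its child.  A
-- vertex u ∉ D has two designated D-neighbours, its entry and its exit; the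
-- edge to the entry gets the root's rank, its other edges the extra colour.
-- Two vertices of D are joined by their tree path, whose colours are ranks of
-- distinct non-root vertices of D; an outside endpoint is attached through its
-- entry (first edge) or its exit (last edge), whose colours are thus fresh.

open import Defs
open import Data.Nat using (ℕ; zero; suc; _+_; _<_; _≤_; _≤?_; _<?_; z≤n; s≤s)
open import Data.Nat.Properties
  using (<-irrefl; <-asym; <-trans; <⇒≤; <⇒≱; ≤-<-trans; ≤-refl; ≰⇒>; +-monoˡ-<; +-monoʳ-<; module ≤-Reasoning)
open import Data.Nat.Induction using (<-wellFounded)
open import Induction.WellFounded using (Acc; acc)
open import Data.Fin using (Fin; zero; suc; fromℕ; _≟_)
open import Data.Fin.Properties using (suc-injective)
open import Data.Fin.Subset using (Subset; _∈_; _∉_; ∣_∣; inside; outside)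
open import Data.Fin.Subset.Properties using (_∈?_)
open import Data.Vec using (_∷_; here; there)
open import Data.List using (List; []; _∷_; _∷ʳ_; allFin)
open import Data.List.Membership.Propositional using () renaming (_∈_ to _∈ₗ_; _∉_ to _∉ₗ_)
open import Data.List.Membership.Propositional.Properties using (∈-allFin)
open import Data.List.Relation.Unary.All as All using (All; []; _∷_)
open import Data.List.Relation.Unary.All.Properties using (¬Any⇒All¬; ∷ʳ⁺)
open import Data.List.Relation.Unary.Any as Any using (here; there)
open import Data.List.Relation.Unary.Unique.Propositional using (Unique)
import Data.List.Relation.Unary.Unique.Propositional.Properties as Unique
open import Data.List.Relation.Unary.AllPairs using ([]; _∷_)
open import Data.Product using (Σ; ∃; _×_; _,_; proj₁; proj₂)
open import Data.Sum using (_⊎_; inj₁; inj₂; map₁; map₂; swap)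
open import Data.Empty using (⊥-elim)
open import Function using (_∘_)
open import Relation.Binary.PropositionalEquality
  using (_≡_; _≢_; refl; trans; cong; subst; ≢-sym; module ≡-Reasoning)
  renaming (sym to ≡-sym)
open import Relation.Nullary using (¬_; Dec; yes; no)

unique-∷ʳ : ∀ {A : Set} {xs : List A} {x : A} → Unique xs → x ∉ₗ xs → Unique (xs ∷ʳ x)
unique-∷ʳ unique x∉xs = Unique.++⁺ unique ([] ∷ []) λ { (x∈xs , here refl) → x∉xs x∈xs }

∉-resp : ∀ {A : Set} {xs : List A} {x y : A} → x ≡ y → y ∉ₗ xs → x ∉ₗ xs
∉-resp refl y∉xs = y∉xs

omits : ∀ {A : Set} {P : A → Set} {xs : List A} {x : A} → All P xs → ¬ P x → x ∉ₗ xs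
omits all ¬Px x∈xs = ¬Px (All.lookup all x∈xs)

module Walks {n : ℕ} (G : Graph n) where

  _++ʷ_ : ∀ {u v w} → Walk G u v → Walk G v w → Walk G u w
  [ u ] ++ʷ q = q
  (u ∷⟨ e ⟩ p) ++ʷ q = u ∷⟨ e ⟩ (p ++ʷ q)

  _▷_ : ∀ {u v w} → Walk G u v → Adj G v w → Walk G u w
  [ u ] ▷ e = u ∷⟨ e ⟩ [ _ ]
  (u ∷⟨ e′ ⟩ p) ▷ e = u ∷⟨ e′ ⟩ (p ▷ e)

  start∈ : ∀ {u v} (p : Walk G u v) → u ∈ₗ vertices p
  start∈ [ u ] = here refl
  start∈ (u ∷⟨ e ⟩ p) = here refl

  end∈ : ∀ {u v} (p : Walk G u v) → v ∈ₗ vertices p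
  end∈ [ u ] = here refl
  end∈ (u ∷⟨ e ⟩ p) = there (end∈ p)

  ∈-++ʷˡ : ∀ {u v w x} (p : Walk G u v) (q : Walk G v w) → x ∈ₗ vertices p → x ∈ₗ vertices (p ++ʷ q)
  ∈-++ʷˡ [ u ] q (here refl) = start∈ q
  ∈-++ʷˡ (u ∷⟨ e ⟩ p) q (here refl) = here refl
  ∈-++ʷˡ (u ∷⟨ e ⟩ p) q (there x∈p) = there (∈-++ʷˡ p q x∈p)

  All-++ʷ : ∀ {P : Fin n → Set} {u v w} (p : Walk G u v) (q : Walk G v w) →
    All P (vertices p) → All P (vertices q) → All P (vertices (p ++ʷ q))
  All-++ʷ [ u ] q _ Pq = Pq
  All-++ʷ (u ∷⟨ e ⟩ p) q (Pu ∷ Pp) Pq = Pu ∷ All-++ʷ p q Pp Pq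

  vertices-▷ : ∀ {u v w} (p : Walk G u v) (e : Adj G v w) → vertices (p ▷ e) ≡ vertices p ∷ʳ w
  vertices-▷ [ u ] e = refl
  vertices-▷ (u ∷⟨ e′ ⟩ p) e = cong (u ∷_) (vertices-▷ p e)

  colours-▷ : ∀ {k u v w} (c : EdgeColouring G k) (p : Walk G u v) (e : Adj G v w) →
    colours c (p ▷ e) ≡ colours c p ∷ʳ col c v w e
  colours-▷ c [ u ] e = refl
  colours-▷ c (u ∷⟨ e′ ⟩ p) e = cong (_ ∷_) (colours-▷ c p e)

  All-▷ : ∀ {P : Fin n → Set} {u v w} (p : Walk G u v) (e : Adj G v w) →
    All P (vertices p) → P w → All P (vertices (p ▷ e))
  All-▷ p e Pp Pw = subst (All _) (≡-sym (vertices-▷ p e)) (∷ʳ⁺ Pp Pw)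

  All-colours-▷ : ∀ {k} {P : Fin k → Set} (c : EdgeColouring G k) {u v w} (p : Walk G u v) (e : Adj G v w) →
    All P (colours c p) → P (col c v w e) → All P (colours c (p ▷ e))
  All-colours-▷ c p e Pp Pe = subst (All _) (≡-sym (colours-▷ c p e)) (∷ʳ⁺ Pp Pe)

  rainbow-∷ : ∀ {k u w v} (c : EdgeColouring G k) (e : Adj G u w) (p : Walk G w v) →
    u ∉ₗ vertices p → col c u w e ∉ₗ colours c p → RainbowPath c p → RainbowPath c (u ∷⟨ e ⟩ p)
  rainbow-∷ c e p u∉p colour∉p (unique , uniqueColours) =
    ¬Any⇒All¬ _ u∉p ∷ unique , ¬Any⇒All¬ _ colour∉p ∷ uniqueColours

  rainbow-▷ : ∀ {k u v w} (c : EdgeColouring G k) (p : Walk G u v) (e : Adj G v w) →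
    w ∉ₗ vertices p → col c v w e ∉ₗ colours c p → RainbowPath c p → RainbowPath c (p ▷ e)
  rainbow-▷ c p e w∉p colour∉p (unique , uniqueColours) =
    subst Unique (≡-sym (vertices-▷ p e)) (unique-∷ʳ unique w∉p) ,
    subst Unique (≡-sym (colours-▷ c p e)) (unique-∷ʳ uniqueColours colour∉p)

  firstIndex : ∀ {u v} → Walk G u v → Fin n → ℕ
  firstIndex [ u ] x = 0
  firstIndex (u ∷⟨ e ⟩ p) x with x ≟ u
  ... | yes _ = 0
  ... | no _ = suc (firstIndex p x)

  -- The vertex from which a walk first reaches x (meaningful when x ≠ start).
  discoverer : ∀ {u v} → Walk G u v → Fin n → Fin n
  discoverer [ u ] x = u
  discoverer (_∷⟨_⟩_ u {w} e p) x with x ≟ w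
  ... | yes _ = u
  ... | no _ = discoverer p x

  firstIndex-start : ∀ {u v} (p : Walk G u v) → firstIndex p u ≡ 0
  firstIndex-start [ u ] = refl
  firstIndex-start (u ∷⟨ e ⟩ p) with u ≟ u
  ... | yes _ = refl
  ... | no u≢u = ⊥-elim (u≢u refl)

  firstIndex-later : ∀ {u w v x} (e : Adj G u w) (p : Walk G w v) → x ≢ u →
    firstIndex (u ∷⟨ e ⟩ p) x ≡ suc (firstIndex p x)
  firstIndex-later {u} {x = x} e p x≢u with x ≟ u
  ... | yes x≡u = ⊥-elim (x≢u x≡u)
  ... | no _ = refl

  firstIndex-∷ : ∀ {u w v} (e : Adj G u w) (p : Walk G w v) x →
    firstIndex (u ∷⟨ e ⟩ p) x ≤ suc (firstIndex p x)
  firstIndex-∷ {u} e p x with x ≟ u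
  ... | yes _ = z≤n
  ... | no _ = ≤-refl

  discovery : ∀ {u v x} (p : Walk G u v) → x ∈ₗ vertices p → x ≢ u →
    Adj G (discoverer p x) x × discoverer p x ∈ₗ vertices p ×
    firstIndex p (discoverer p x) < firstIndex p x
  discovery [ u ] (here x≡u) x≢u = ⊥-elim (x≢u x≡u)
  discovery {x = x} (_∷⟨_⟩_ u {w} e p) x∈ x≢u with x ≟ w
  ... | yes refl = e , here refl , (begin-strict
      firstIndex (u ∷⟨ e ⟩ p) u ≡⟨ firstIndex-start (u ∷⟨ e ⟩ p) ⟩
      0                         <⟨ s≤s z≤n ⟩
      suc (firstIndex p x)      ≡⟨ ≡-sym (firstIndex-later e p x≢u) ⟩
      firstIndex (u ∷⟨ e ⟩ p) x ∎)
    where open ≤-Reasoning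
  ... | no x≢w with discovery p (Any.tail x≢u x∈) x≢w
  ...   | adjacent , d∈p , earlier = adjacent , there d∈p , (begin-strict
      firstIndex (u ∷⟨ e ⟩ p) (discoverer p x) ≤⟨ firstIndex-∷ e p (discoverer p x) ⟩
      suc (firstIndex p (discoverer p x))      <⟨ s≤s earlier ⟩
      suc (firstIndex p x)                     ≡⟨ ≡-sym (firstIndex-later e p x≢u) ⟩
      firstIndex (u ∷⟨ e ⟩ p) x                ∎)
    where open ≤-Reasoning

record Tour {n : ℕ} (G : Graph n) (D : Subset n) (r : Fin n) (xs : List (Fin n)) : Set where
  field
    {last}  : Fin n
    route   : Walk G r last
    route⊆D : All (_∈ D) (vertices route)
    visits  : ∀ {x} → x ∈ₗ xs → x ∈ D → x ∈ₗ vertices route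

-- When G[D] is connected such tours exist for every list: walk on from the
-- end of a tour to each further vertex of D inside D.
tour : ∀ {n} {G : Graph n} {D : Subset n} {r : Fin n} → InducedConnected G D → r ∈ D →
  (xs : List (Fin n)) → Tour G D r xs
tour ic r∈D [] = record { route = [ _ ] ; route⊆D = r∈D ∷ [] ; visits = λ () }
tour {G = G} {D} ic r∈D (x ∷ xs) with x ∈? D
... | no x∉D = record { route = route ; route⊆D = route⊆D ; visits = visits′ }
  where
  open Tour (tour ic r∈D xs)
  visits′ : ∀ {y} → y ∈ₗ x ∷ xs → y ∈ D → y ∈ₗ vertices route
  visits′ (here refl) x∈D = ⊥-elim (x∉D x∈D)
  visits′ (there y∈xs) y∈D = visits y∈xs y∈D
... | yes x∈D = record { route = route ++ʷ q ; route⊆D = All-++ʷ route q route⊆D q⊆D ; visits = visits′ }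
  where
  open Walks G
  open Tour (tour ic r∈D xs)
  extension : Σ (Walk G last x) λ q → All (_∈ D) (vertices q)
  extension = ic last x (All.lookup route⊆D (end∈ route)) x∈D
  q : Walk G last x
  q = proj₁ extension
  q⊆D : All (_∈ D) (vertices q)
  q⊆D = proj₂ extension
  visits′ : ∀ {y} → y ∈ₗ x ∷ xs → y ∈ D → y ∈ₗ vertices (route ++ʷ q)
  visits′ (here refl) _ = end∈ (route ++ʷ q)
  visits′ (there y∈xs) y∈D = ∈-++ʷˡ route q (visits y∈xs y∈D)

rank : ∀ {n} (D : Subset n) → Fin n → Fin (suc ∣ D ∣)
rank (inside ∷ D) zero = zero
rank (outside ∷ D) zero = zero
rank (inside ∷ D) (suc x) = suc (rank D x)
rank (outside ∷ D) (suc x) = rank D x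

rank-injective : ∀ {n} (D : Subset n) {x y : Fin n} → x ∈ D → y ∈ D → rank D x ≡ rank D y → x ≡ y
rank-injective (inside ∷ D) here here _ = refl
rank-injective (inside ∷ D) here (there _) ()
rank-injective (inside ∷ D) (there _) here ()
rank-injective (inside ∷ D) (there x∈D) (there y∈D) eq = cong suc (rank-injective D x∈D y∈D (suc-injective eq))
rank-injective (outside ∷ D) (there x∈D) (there y∈D) eq = cong suc (rank-injective D x∈D y∈D eq)

rank≢extra : ∀ {n} (D : Subset n) {x : Fin n} → x ∈ D → rank D x ≢ fromℕ ∣ D ∣
rank≢extra (inside ∷ D) here ()
rank≢extra (inside ∷ D) (there x∈D) eq = rank≢extra D x∈D (suc-injective eq)
rank≢extra (outside ∷ D) (there x∈D) eq = rank≢extra D x∈D eq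

module FromRoot {n : ℕ} (G : Graph n) (D : Subset n) (ic : InducedConnected G D)
  (two : (v : Fin n) → v ∉ D → TwoNeighboursIn G D v) (r : Fin n) (r∈D : r ∈ D) where

  open Walks G
  open Tour (tour ic r∈D (allFin n))

  h : Fin n → ℕ
  h = firstIndex route

  par : Fin n → Fin n
  par = discoverer route

  parent : ∀ {x} → x ∈ D → x ≢ r → Adj G x (par x) × par x ∈ D × h (par x) < h x
  parent x∈D x≢r with discovery route (visits (∈-allFin _) x∈D) x≢r
  ... | adjacent , p∈route , earlier = sym G adjacent , All.lookup route⊆D p∈route , earlier

  parent-adj : ∀ {x} → x ∈ D → x ≢ r → Adj G x (par x)
  parent-adj x∈D x≢r = proj₁ (parent x∈D x≢r)

  parent∈D : ∀ {x} → x ∈ D → x ≢ r → par x ∈ D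
  parent∈D x∈D x≢r = proj₁ (proj₂ (parent x∈D x≢r))

  parent-earlier : ∀ {x} → x ∈ D → x ≢ r → h (par x) < h x
  parent-earlier x∈D x≢r = proj₂ (proj₂ (parent x∈D x≢r))

  -- the root is discovered first, so of two distinct vertices of D the one
  -- discovered no earlier is not the root
  notRoot : ∀ {x y} → y ∈ D → x ≢ y → h y ≤ h x → x ≢ r
  notRoot y∈D r≢y y≤r refl =
    <⇒≱ (≤-<-trans z≤n (parent-earlier y∈D (≢-sym r≢y))) (subst (h _ ≤_) (firstIndex-start route) y≤r)

  entry exit : Fin n → Fin n
  entry u with u ∈? D
  ... | yes _ = u
  ... | no u∉D = proj₁ (two u u∉D)
  exit u with u ∈? D
  ... | yes _ = u
  ... | no u∉D = proj₁ (proj₂ (two u u∉D))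

  attachment : ∀ {u} → u ∉ D →
    entry u ≢ exit u × entry u ∈ D × exit u ∈ D × Adj G u (entry u) × Adj G u (exit u)
  attachment {u} u∉D with u ∈? D
  ... | yes u∈D = ⊥-elim (u∉D u∈D)
  ... | no u∉D′ = proj₂ (proj₂ (two u u∉D′))

  entry∈D : ∀ {u} → u ∉ D → entry u ∈ D
  entry∈D u∉D = proj₁ (proj₂ (attachment u∉D))

  exit∈D : ∀ {u} → u ∉ D → exit u ∈ D
  exit∈D u∉D = proj₁ (proj₂ (proj₂ (attachment u∉D)))

  entry-adj : ∀ {u} → u ∉ D → Adj G u (entry u)
  entry-adj u∉D = proj₁ (proj₂ (proj₂ (proj₂ (attachment u∉D))))

  exit-adj : ∀ {u} → u ∉ D → Adj G (exit u) u
  exit-adj u∉D = sym G (proj₂ (proj₂ (proj₂ (proj₂ (attachment u∉D)))))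

  Colour : Set
  Colour = Fin (suc ∣ D ∣)

  rk : Fin n → Colour
  rk = rank D

  extra : Colour
  extra = fromℕ ∣ D ∣

  innerColour : Fin n → Fin n → Colour
  innerColour u v with h u <? h v | h v <? h u
  ... | yes _ | _ = rk v
  ... | no _ | yes _ = rk u
  ... | no _ | no _ = rk r

  innerColour-sym : ∀ u v → innerColour v u ≡ innerColour u v
  innerColour-sym u v with h u <? h v | h v <? h u
  ... | yes u<v | yes v<u = ⊥-elim (<-asym u<v v<u)
  ... | yes _ | no _ = refl
  ... | no _ | yes _ = refl
  ... | no _ | no _ = refl

  innerColour-later : ∀ {u v} → h v < h u → innerColour u v ≡ rk u
  innerColour-later {u} {v} v<u with h u <? h v | h v <? h u
  ... | yes u<v | _ = ⊥-elim (<-asym u<v v<u)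
  ... | no _ | yes _ = refl
  ... | no _ | no v≮u = ⊥-elim (v≮u v<u)

  outerColour : Fin n → Fin n → Colour
  outerColour u v with v ≟ entry u
  ... | yes _ = rk r
  ... | no _ = extra

  outerColour-entry : ∀ u → outerColour u (entry u) ≡ rk r
  outerColour-entry u with entry u ≟ entry u
  ... | yes _ = refl
  ... | no e≢e = ⊥-elim (e≢e refl)

  outerColour-other : ∀ {u v} → v ≢ entry u → outerColour u v ≡ extra
  outerColour-other {u} {v} v≢entry with v ≟ entry u
  ... | yes v≡entry = ⊥-elim (v≢entry v≡entry)
  ... | no _ = refl

  -- the full colouring, by cases on membership in D; the case distinction is
  -- taken as an argument so that symmetry can be proved case by case
  colourBy : (u v : Fin n) → Dec (u ∈ D) → Dec (v ∈ D) → Colour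
  colourBy u v (yes _) (yes _) = innerColour u v
  colourBy u v (no _) (yes _) = outerColour u v
  colourBy u v (yes _) (no _) = outerColour v u
  colourBy u v (no _) (no _) = extra

  colour : Fin n → Fin n → Colour
  colour u v = colourBy u v (u ∈? D) (v ∈? D)

  colour-sym : ∀ u v → colour v u ≡ colour u v
  colour-sym u v = by (u ∈? D) (v ∈? D)
    where
    by : ∀ du dv → colourBy v u dv du ≡ colourBy u v du dv
    by (yes _) (yes _) = innerColour-sym u v
    by (no _) (yes _) = refl
    by (yes _) (no _) = refl
    by (no _) (no _) = refl

  colour-inner : ∀ {u v} → u ∈ D → v ∈ D → colour u v ≡ innerColour u v
  colour-inner {u} {v} u∈D v∈D = by (u ∈? D) (v ∈? D)
    where
    by : ∀ du dv → colourBy u v du dv ≡ innerColour u v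
    by (yes _) (yes _) = refl
    by (no u∉D) _ = ⊥-elim (u∉D u∈D)
    by (yes _) (no v∉D) = ⊥-elim (v∉D v∈D)

  colour-outer : ∀ {u v} → u ∉ D → v ∈ D → colour u v ≡ outerColour u v
  colour-outer {u} {v} u∉D v∈D = by (u ∈? D) (v ∈? D)
    where
    by : ∀ du dv → colourBy u v du dv ≡ outerColour u v
    by (no _) (yes _) = refl
    by (yes u∈D) _ = ⊥-elim (u∉D u∈D)
    by (no _) (no v∉D) = ⊥-elim (v∉D v∈D)

  colouring : EdgeColouring G (suc ∣ D ∣)
  colouring = record { col = λ u v _ → colour u v ; col-sym = λ {u} {v} _ → colour-sym u v }

  tree-colour : ∀ {x} → x ∈ D → x ≢ r → colour (par x) x ≡ rk x
  tree-colour {x} x∈D x≢r = begin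
    colour (par x) x      ≡⟨ colour-sym x (par x) ⟩
    colour x (par x)      ≡⟨ colour-inner x∈D (parent∈D x∈D x≢r) ⟩
    innerColour x (par x) ≡⟨ innerColour-later (parent-earlier x∈D x≢r) ⟩
    rk x                  ∎
    where open ≡-Reasoning

  entry-colour : ∀ {u} → u ∉ D → colour u (entry u) ≡ rk r
  entry-colour {u} u∉D = trans (colour-outer u∉D (entry∈D u∉D)) (outerColour-entry u)

  exit-colour : ∀ {v} → v ∉ D → colour (exit v) v ≡ extra
  exit-colour {v} v∉D = begin
    colour (exit v) v      ≡⟨ colour-sym v (exit v) ⟩
    colour v (exit v)      ≡⟨ colour-outer v∉D (exit∈D v∉D) ⟩
    outerColour v (exit v) ≡⟨ outerColour-other (≢-sym (proj₁ (attachment v∉D))) ⟩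
    extra                  ∎
    where open ≡-Reasoning

  Earlier : Fin n → Fin n → Set
  Earlier z w = z ≡ w ⊎ h z < h w

  Span : Fin n → Fin n → Fin n → Set
  Span x y z = Earlier z x ⊎ Earlier z y

  earlier-raise : ∀ {z w x} → h w < h x → Earlier z w → Earlier z x
  earlier-raise w<x (inj₁ refl) = inj₂ w<x
  earlier-raise w<x (inj₂ z<w) = inj₂ (<-trans z<w w<x)

  unreached : ∀ {a b x} → h a < h x → h b ≤ h x → x ≢ b → ¬ Span a b x
  unreached a<x b≤x x≢b (inj₁ (inj₁ refl)) = <-irrefl refl a<x
  unreached a<x b≤x x≢b (inj₁ (inj₂ x<a)) = <-asym x<a a<x
  unreached a<x b≤x x≢b (inj₂ (inj₁ x≡b)) = x≢b x≡b
  unreached a<x b≤x x≢b (inj₂ (inj₂ x<b)) = <⇒≱ x<b b≤x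

  record RankOf (P : Fin n → Set) (c : Colour) : Set where
    constructor rankOf
    field
      vertex   : Fin n
      vertex∈D : vertex ∈ D
      vertex≢r : vertex ≢ r
      holds    : P vertex
      is-rank  : c ≡ rk vertex

  rankOf-map : ∀ {P Q : Fin n → Set} → (∀ {z} → P z → Q z) → ∀ {c} → RankOf P c → RankOf Q c
  rankOf-map f (rankOf z z∈D z≢r Pz c≡z) = rankOf z z∈D z≢r (f Pz) c≡z

  rank-fresh : ∀ {P : Fin n → Set} {x cs} → x ∈ D → ¬ P x → All (RankOf P) cs → rk x ∉ₗ cs
  rank-fresh {P} x∈D ¬Px ranks x∈cs with All.lookup ranks x∈cs
  ... | rankOf z z∈D _ Pz x≡z = ¬Px (subst P (≡-sym (rank-injective D x∈D z∈D x≡z)) Pz)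

  root-fresh : ∀ {P cs} → All (RankOf P) cs → rk r ∉ₗ cs
  root-fresh ranks r∈cs with All.lookup ranks r∈cs
  ... | rankOf z z∈D z≢r _ r≡z = z≢r (≡-sym (rank-injective D r∈D z∈D r≡z))

  extra-fresh : ∀ {P cs} → All (RankOf P) cs → extra ∉ₗ cs
  extra-fresh ranks extra∈cs with All.lookup ranks extra∈cs
  ... | rankOf z z∈D _ _ extra≡z = rank≢extra D z∈D (≡-sym extra≡z)

  record TreePath (x y : Fin n) : Set where
    field
      walk    : Walk G x y
      walk⊆D  : All (_∈ D) (vertices walk)
      spanned : All (Span x y) (vertices walk)
      rainbow : RainbowPath colouring walk
      ranked  : All (RankOf (Span x y)) (colours colouring walk)
  open TreePath

  trivialPath : ∀ {x} → x ∈ D → TreePath x x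
  trivialPath {x} x∈D = record
    { walk = [ x ] ; walk⊆D = x∈D ∷ [] ; spanned = inj₁ (inj₁ refl) ∷ []
    ; rainbow = [] ∷ [] , [] ; ranked = [] }

  stepUp : ∀ {x y} → x ∈ D → (x≢r : x ≢ r) → ¬ Span (par x) y x → TreePath (par x) y → TreePath x y
  stepUp {x} {y} x∈D x≢r fresh t = record
    { walk = x ∷⟨ e ⟩ walk t
    ; walk⊆D = x∈D ∷ walk⊆D t
    ; spanned = inj₁ (inj₁ refl) ∷ All.map raise (spanned t)
    ; rainbow = rainbow-∷ colouring e (walk t) (omits (spanned t) fresh) colour∉ (rainbow t)
    ; ranked = rankOf x x∈D x≢r (inj₁ (inj₁ refl)) edge-colour ∷ All.map (rankOf-map raise) (ranked t)
    }
    where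
    e : Adj G x (par x)
    e = parent-adj x∈D x≢r
    raise : ∀ {z} → Span (par x) y z → Span x y z
    raise = map₁ (earlier-raise (parent-earlier x∈D x≢r))
    edge-colour : colour x (par x) ≡ rk x
    edge-colour = trans (colour-sym (par x) x) (tree-colour x∈D x≢r)
    colour∉ : colour x (par x) ∉ₗ colours colouring (walk t)
    colour∉ = ∉-resp edge-colour (rank-fresh x∈D fresh (ranked t))

  stepDown : ∀ {x y} → y ∈ D → (y≢r : y ≢ r) → ¬ Span x (par y) y → TreePath x (par y) → TreePath x y
  stepDown {x} {y} y∈D y≢r fresh t = record
    { walk = walk t ▷ e
    ; walk⊆D = All-▷ (walk t) e (walk⊆D t) y∈D
    ; spanned = All-▷ (walk t) e (All.map raise (spanned t)) (inj₂ (inj₁ refl))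
    ; rainbow = rainbow-▷ colouring (walk t) e (omits (spanned t) fresh) colour∉ (rainbow t)
    ; ranked = All-colours-▷ colouring (walk t) e (All.map (rankOf-map raise) (ranked t))
                  (rankOf y y∈D y≢r (inj₂ (inj₁ refl)) (tree-colour y∈D y≢r))
    }
    where
    e : Adj G (par y) y
    e = sym G (parent-adj y∈D y≢r)
    raise : ∀ {z} → Span x (par y) z → Span x y z
    raise = map₂ (earlier-raise (parent-earlier y∈D y≢r))
    colour∉ : colour (par y) y ∉ₗ colours colouring (walk t)
    colour∉ = ∉-resp (tree-colour y∈D y≢r) (rank-fresh y∈D fresh (ranked t))

  -- tree paths by induction on h x + h y: move up from the later endpoint
  treePathAcc : ∀ {x y} → x ∈ D → y ∈ D → Acc _<_ (h x + h y) → TreePath x y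
  treePathAcc {x} {y} x∈D y∈D (acc smaller) with x ≟ y | h y ≤? h x
  ... | yes refl | _ = trivialPath x∈D
  ... | no x≢y | yes y≤x =
    stepUp x∈D x≢r (unreached x-later y≤x x≢y)
      (treePathAcc (parent∈D x∈D x≢r) y∈D (smaller (+-monoˡ-< (h y) x-later)))
    where
    x≢r : x ≢ r
    x≢r = notRoot y∈D x≢y y≤x
    x-later : h (par x) < h x
    x-later = parent-earlier x∈D x≢r
  ... | no x≢y | no y≰x =
    stepDown y∈D y≢r (unreached y-later (<⇒≤ x<y) (≢-sym x≢y) ∘ swap)
      (treePathAcc x∈D (parent∈D y∈D y≢r) (smaller (+-monoʳ-< (h x) y-later)))
    where
    x<y : h x < h y
    x<y = ≰⇒> y≰x
    y≢r : y ≢ r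
    y≢r = notRoot x∈D (≢-sym x≢y) (<⇒≤ x<y)
    y-later : h (par y) < h y
    y-later = parent-earlier y∈D y≢r

  treePath : ∀ {x y} → x ∈ D → y ∈ D → TreePath x y
  treePath x∈D y∈D = treePathAcc x∈D y∈D (<-wellFounded _)

  enter : ∀ {u y} (u∉D : u ∉ D) (p : Walk G (entry u) y) → u ∉ₗ vertices p →
    rk r ∉ₗ colours colouring p → RainbowPath colouring p → RainbowPath colouring (u ∷⟨ entry-adj u∉D ⟩ p)
  enter u∉D p u∉p root∉p =
    rainbow-∷ colouring (entry-adj u∉D) p u∉p (∉-resp (entry-colour u∉D) root∉p)

  leave : ∀ {x v} (v∉D : v ∉ D) (p : Walk G x (exit v)) → v ∉ₗ vertices p →
    extra ∉ₗ colours colouring p → RainbowPath colouring p → RainbowPath colouring (p ▷ exit-adj v∉D)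
  leave v∉D p v∉p extra∉p =
    rainbow-▷ colouring p (exit-adj v∉D) v∉p (∉-resp (exit-colour v∉D) extra∉p)

  rainbowPath : (u v : Fin n) → Σ (Walk G u v) (RainbowPath colouring)
  rainbowPath u v with u ∈? D | v ∈? D
  ... | yes u∈D | yes v∈D = walk t , rainbow t
    where
    t : TreePath u v
    t = treePath u∈D v∈D
  ... | no u∉D | yes v∈D = u ∷⟨ entry-adj u∉D ⟩ walk t ,
    enter u∉D (walk t) (omits (walk⊆D t) u∉D) (root-fresh (ranked t)) (rainbow t)
    where
    t : TreePath (entry u) v
    t = treePath (entry∈D u∉D) v∈D
  ... | yes u∈D | no v∉D = walk t ▷ exit-adj v∉D ,
    leave v∉D (walk t) (omits (walk⊆D t) v∉D) (extra-fresh (ranked t)) (rainbow t)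
    where
    t : TreePath u (exit v)
    t = treePath u∈D (exit∈D v∉D)
  ... | no u∉D | no v∉D with u ≟ v
  ...   | yes refl = [ u ] , [] ∷ [] , []
  ...   | no u≢v = p ▷ exit-adj v∉D ,
    leave v∉D p v∉p extra∉p (enter u∉D (walk t) (omits (walk⊆D t) u∉D) (root-fresh (ranked t)) (rainbow t))
    where
    t : TreePath (entry u) (exit v)
    t = treePath (entry∈D u∉D) (exit∈D v∉D)
    p : Walk G u (exit v)
    p = u ∷⟨ entry-adj u∉D ⟩ walk t
    v∉p : v ∉ₗ vertices p
    v∉p (here v≡u) = u≢v (≡-sym v≡u)
    v∉p (there v∈t) = omits (walk⊆D t) v∉D v∈t
    extra∉p : extra ∉ₗ colours colouring p
    extra∉p (here extra≡) = rank≢extra D r∈D (≡-sym (trans extra≡ (entry-colour u∉D)))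
    extra∉p (there extra∈t) = extra-fresh (ranked t) extra∈t

  rainbowColouring : rc≤ G (suc ∣ D ∣)
  rainbowColouring = colouring , rainbowPath

-- Every vertex outside D has a neighbour in D, so D is nonempty once G has a vertex.
member : ∀ {n} {G : Graph n} {D : Subset n} → Fin n →
  ((v : Fin n) → v ∉ D → TwoNeighboursIn G D v) → ∃ (_∈ D)
member {D = D} u two with u ∈? D
... | yes u∈D = u , u∈D
... | no u∉D = proj₁ (two u u∉D) , proj₁ (proj₂ (proj₂ (proj₂ (two u u∉D))))

rc-empty : (G : Graph 0) (k : ℕ) → rc≤ G k
rc-empty G k = record { col = λ () ; col-sym = λ { {()} } } , λ ()

lemma1 : (n : ℕ) (G : Graph n) → Connected G → (D : Subset n) →
    InducedConnected G D →
    ((v : Fin n) → v ∉ D → TwoNeighboursIn G D v) →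
    rc≤ G (suc ∣ D ∣)
lemma1 zero G _ D _ _ = rc-empty G (suc ∣ D ∣)
lemma1 (suc m) G _ D ic two with member {G = G} zero two
... | r , r∈D = FromRoot.rainbowColouring G D ic two r r∈D
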